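{- Let $H=([n],E)$ be a hypergraph having at least one edge of cardinality greater than $2$, and assume that $H$ has two disjoint edges. Then the coloring complex $\Delta_H$ is not Cohen-Macaulay over any field.
   Context: A hypergraph $H=([n],E)$ consists of the vertex set $[n]$ and a set $E$ of subsets of $[n]$ called edges; throughout, hypergraphs have no edges of cardinality at most $1$, no isolated vertices, and no two edges $F,F'$ with $F\subsetneq F'$. The coloring complex $\Delta_H$ is the simplicial complex whose vertex set is the set of nonempty proper subsets of $[n]$ and whose faces are the chains $\emptyset\ne A_1\subsetneq\cdots\subsetneq A_l\ne[n]$ ($l\ge0$) such that, with $A_0=\emptyset$, $A_{l+1}=[n]$, some difference $A_i\setminus A_{i-1}$ ($1\le i\le l+1$) contains an edge of $H$. (Equivalently, faces are ordered set partitions of $[n]$ into nonempty blocks, at least one block containing an edge.) -}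

module Defs where

open import Level using (Level; _⊔_)
open import Data.Nat using (ℕ; zero; suc; _<_; _≤_)
open import Data.Bool using (Bool; true; false)
open import Data.Fin using (Fin; toℕ)
open import Data.List using (List; []; _∷_; _++_; map; foldr; length; insertAt; allFin)
open import Data.List.Membership.Propositional using () renaming (_∈_ to _∈ₗ_; _∉_ to _∉ₗ_)
open import Data.List.Relation.Unary.Linked using (Linked)
open import Data.Fin.Subset using (Subset; _∈_; _⊆_; _⊂_; _─_; ⊥; ⊤; inside; outside)
open import Data.Product using (Σ; ∃; ∃-syntax; _×_; _,_)
open import Data.Sum using (_⊎_)
open import Data.Vec using (Vec; []; _∷_)
open import Relation.Nullary using (¬_)
open import Relation.Binary.PropositionalEquality using (_≡_)
open import Function.Bundles using (_⇔_)
open import Algebra.Bundles using (CommutativeRing)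

record Field (c ℓ : Level) : Set (Level.suc (c ⊔ ℓ)) where
  field
    commutativeRing : CommutativeRing c ℓ
  open CommutativeRing commutativeRing public
  field
    1≉0     : ¬ (1# ≈ 0#)
    inverse : ∀ x → ¬ (x ≈ 0#) → ∃[ y ] (x * y ≈ 1#)

-- Abstract simplicial complexes on a finite vertex type V, given by
--   * enum : a list enumerating every vertex of V exactly once,
--   * a predicate Face on lists of vertices; faces are represented
--     canonically (each face by exactly one list, e.g. sorted).
-- Chains with coefficients in K are functions  List V → K  vanishing on
-- non-faces; a chain "of size k" is looked at only on faces with k
-- vertices (dimension k-1).  The empty list is the empty face, so the
-- chain complex is the augmented one and homology is reduced homology.

module _ {c ℓ : Level} (K : Field c ℓ) {V : Set} (enum : List V) where
  open Field K

  alt : ℕ → Carrier → Carrier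
  alt zero          x = x
  alt (suc zero)    x = - x
  alt (suc (suc j)) x = alt j x

  sumK : List Carrier → Carrier
  sumK = foldr _+_ 0#

  ∂ : (List V → Carrier) → List V → Carrier
  ∂ ch G = sumK (Data.List.concatMap
                   (λ j → map (λ v → alt (toℕ j) (ch (insertAt G j v))) enum)
                   (allFin (suc (length G))))

  -- Reduced homology in degree k-1 (chains on faces with k vertices) vanishes:
  -- every (k-1)-cycle is a boundary.
  ReducedHomologyVanishes : (List V → Set) → ℕ → Set (c ⊔ ℓ)
  ReducedHomologyVanishes Face k =
    (ch : List V → Carrier) →
    (∀ L → ¬ Face L → ch L ≈ 0#) →
    (∀ G → Face G → suc (length G) ≡ k → ∂ ch G ≈ 0#) →
    Σ (List V → Carrier) λ d →
      (∀ L → ¬ Face L → d L ≈ 0#) ×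
      (∀ G → Face G → length G ≡ k → ∂ d G ≈ ch G)

  LinkFace : (_≺_ : V → V → Set) → (List V → Set) → List V → List V → Set
  LinkFace _≺_ Face F G =
    Linked _≺_ G ×
    (∀ x → x ∈ₗ G → x ∉ₗ F) ×
    ∃[ L ] (Face L × (∀ x → (x ∈ₗ L) ⇔ (x ∈ₗ G ⊎ x ∈ₗ F)))

  -- Cohen–Macaulay over K (Reisner's criterion): for every face F
  -- (including the empty face, whose link is the complex itself) and every
  -- i < dim lk F, the reduced homology H̃_i(lk F; K) vanishes.
  -- With k = i+1:  i < dim lk F  ⇔  k < (number of vertices of some face of lk F).
  CohenMacaulay : (_≺_ : V → V → Set) → (List V → Set) → Set (c ⊔ ℓ)
  CohenMacaulay _≺_ Face =
    ∀ F → Face F → ∀ k →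
    (∃[ G ] (LinkFace _≺_ Face F G × k < length G)) →
    ReducedHomologyVanishes (LinkFace _≺_ Face F) k

allSubsets : ∀ n → List (Subset n)
allSubsets zero    = [] ∷ []
allSubsets (suc n) = map (inside ∷_) (allSubsets n) ++ map (outside ∷_) (allSubsets n)

IsHypergraph : ∀ n → List (Subset n) → Set
IsHypergraph n E =
  (∀ e → e ∈ₗ E → 2 ≤ Data.Fin.Subset.∣ e ∣) ×
  (∀ (x : Fin n) → ∃[ e ] (e ∈ₗ E × x ∈ e)) ×
  (∀ e e' → e ∈ₗ E → e' ∈ₗ E → ¬ (e ⊂ e'))

-- A face is a chain ∅ ≠ A₁ ⊊ ⋯ ⊊ A_l ≠ [n], written as the
-- list A₁ ∷ ⋯ ∷ A_l (increasing).  With A₀ = ∅ and A_{l+1} = [n]: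
--   ChainFrom A₀ L  : A₀ ⊊ A₁ ⊊ ⋯ ⊊ A_l ⊊ [n]
--   EdgeGap E A₀ L  : some A_i ─ A_{i-1} (1 ≤ i ≤ l+1) contains an edge of E.
ChainFrom : ∀ {n} → Subset n → List (Subset n) → Set
ChainFrom p []      = p ⊂ ⊤
ChainFrom p (A ∷ L) = p ⊂ A × ChainFrom A L

EdgeGap : ∀ {n} → List (Subset n) → Subset n → List (Subset n) → Set
EdgeGap E p []      = ∃[ e ] (e ∈ₗ E × e ⊆ (⊤ ─ p))
EdgeGap E p (A ∷ L) = ∃[ e ] (e ∈ₗ E × e ⊆ (A ─ p)) ⊎ EdgeGap E A L

ColoringFace : ∀ {n} → List (Subset n) → List (Subset n) → Set
ColoringFace E L = ChainFrom ⊥ L × EdgeGap E ⊥ L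

{-# OPTIONS --safe #-}
module Submission where

-- Reisner's criterion makes every link of dimension at least 1 in a Cohen–Macaulay complex
-- connected, so it suffices to find a face F of Δ_H whose link has an edge but splits into two
-- classes of vertices with no edge between them.  Then the 0-cycle red − blue is not a boundary:
-- the functional "sum of the coefficients on red vertices" vanishes on boundaries but not on it.
--
-- F ends with a maximal chain above a set G, so that the link only sees sets below G.  If an edge
-- e₁ with |e₁| ≥ 3 is disjoint from an edge e₂, take F = (e₁ ⊊ e₁ ∪ e₂ ⊊ ⋯): a link edge joining
-- a set inside e₁ to one between e₁ and e₁ ∪ e₂ would give a face splitting both e₁ and e₂, and
-- every other block is too small or a proper subset of an edge.  Otherwise one of the disjoint
-- edges is a pair {a, b} meeting the large edge g in a only; for F = (g ∪ {b} ⊊ ⋯) the vertex g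
-- of the link is isolated.

open import Defs
open import Level using (Level; _⊔_; 0ℓ)
open import Data.Bool using (true; false; if_then_else_)
import Data.Bool.Properties as Bool
open import Data.Empty using (⊥-elim)
open import Data.Fin using (Fin; zero; suc)
open import Data.Fin.Properties using (_≟_; ¬∀⟶∃¬)
open import Data.Fin.Subset
  using (Subset; Side; inside; outside; _∈_; _∉_; _⊆_; _⊂_; _─_; _∪_; _∩_; ⁅_⁆; ⊥; ⊤; Empty; ∣_∣)
open import Data.Fin.Subset.Properties
open import Data.List using (List; []; _∷_; _++_; map; foldr; filter; length)
open import Data.List.Membership.Propositional using () renaming (_∈_ to _∈ₗ_; _∉_ to _∉ₗ_)
open import Data.List.Membership.Propositional.Properties
  using (∈-map⁺; ∈-++⁺ˡ; ∈-++⁺ʳ; ∈-++⁻; ∈-filter⁺; ∈-filter⁻)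
open import Data.List.Properties using (map-++; map-∘)
open import Data.List.Relation.Unary.All as All using (All; []; _∷_)
open import Data.List.Relation.Unary.AllPairs using ([]; _∷_)
open import Data.List.Relation.Unary.Any as Any using ()
open import Data.List.Relation.Unary.Linked as Linked using (Linked; [-]; _∷_)
open import Data.List.Relation.Unary.Unique.Propositional using (Unique)
open import Data.Nat using (ℕ; zero; suc; _<_; _≤_; _≤?_; s≤s; z≤n)
import Data.Nat.Properties as ℕ
open import Data.Product using (∃-syntax; _×_; _,_; proj₁; proj₂)
open import Data.Sum using (_⊎_; inj₁; inj₂; [_,_]′)
import Data.Sum as Sum
open import Data.Vec using ([]; _∷_; here; there)
open import Data.Vec.Properties using (≡-dec; ∷-injectiveʳ)
open import Function using (_∘_; id; const)
open import Function.Bundles using (_⇔_; mk⇔; Equivalence)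
open import Relation.Binary.Definitions using (DecidableEquality)
open import Relation.Binary.PropositionalEquality as ≡ using (_≡_; _≢_)
open import Relation.Nullary using (¬_; Dec; yes; no; does; ¬?)
open import Relation.Nullary.Decidable using (decidable-stable; _→-dec_; ¬¬-excluded-middle)
open import Relation.Nullary.Negation using (contradiction; ¬¬-Monad)
open import Relation.Unary using (Pred; Decidable)

private variable
  n : ℕ
  s : Side
  x y : Fin n
  p q A B X Y f : Subset n
  L : List (Subset n)
  T U : Set

-- Finite sums and reduced homology in degree 0

module _ {c ℓ : Level} (K : Field c ℓ) where
  open Field K
  open import Algebra.Properties.Ring ring using (-0#≈0#; -‿+-comm)
  open import Algebra.Properties.CommutativeSemigroup +-commutativeSemigroup using (interchange)

  ∑ : List T → (T → Carrier) → Carrier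
  ∑ xs f = foldr _+_ 0# (map f xs)

  sum-++ : ∀ xs ys → foldr _+_ 0# (xs ++ ys) ≈ foldr _+_ 0# xs + foldr _+_ 0# ys
  sum-++ []       ys = sym (+-identityˡ _)
  sum-++ (x ∷ xs) ys = trans (+-congˡ (sum-++ xs ys)) (sym (+-assoc _ _ _))

  sum-++[] : ∀ xs → foldr _+_ 0# (xs ++ []) ≈ foldr _+_ 0# xs
  sum-++[] xs = trans (sum-++ xs []) (+-identityʳ _)

  ∑-++ : ∀ (xs ys : List T) f → ∑ (xs ++ ys) f ≈ ∑ xs f + ∑ ys f
  ∑-++ xs ys f = trans (reflexive (≡.cong (foldr _+_ 0#) (map-++ f xs ys))) (sum-++ (map f xs) (map f ys))

  ∑-map : ∀ (g : T → U) xs f → ∑ (map g xs) f ≡ ∑ xs (f ∘ g)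
  ∑-map g xs f = ≡.cong (foldr _+_ 0#) (≡.sym (map-∘ xs))

  ∑-cong : ∀ {f g : T → Carrier} (xs : List T) → All (λ x → f x ≈ g x) xs → ∑ xs f ≈ ∑ xs g
  ∑-cong []       []            = refl
  ∑-cong (x ∷ xs) (fx≈gx ∷ f≈g) = +-cong fx≈gx (∑-cong xs f≈g)

  ∑-zero : ∀ (xs : List T) {f : T → Carrier} → (∀ x → f x ≈ 0#) → ∑ xs f ≈ 0#
  ∑-zero []       f≈0 = refl
  ∑-zero (x ∷ xs) f≈0 = trans (+-cong (f≈0 x) (∑-zero xs f≈0)) (+-identityˡ 0#)

  ∑-+ : ∀ (xs : List T) (f g : T → Carrier) → ∑ xs (λ x → f x + g x) ≈ ∑ xs f + ∑ xs g
  ∑-+ []       f g = sym (+-identityˡ _)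
  ∑-+ (x ∷ xs) f g = trans (+-congˡ (∑-+ xs f g)) (interchange _ _ _ _)

  ∑-neg : ∀ (xs : List T) (f : T → Carrier) → ∑ xs (λ x → - f x) ≈ - ∑ xs f
  ∑-neg []       f = sym -0#≈0#
  ∑-neg (x ∷ xs) f = trans (+-congˡ (∑-neg xs f)) (-‿+-comm _ _)

  ∑-sub : ∀ (xs : List T) (f g : T → Carrier) → ∑ xs (λ x → f x - g x) ≈ ∑ xs f - ∑ xs g
  ∑-sub xs f g = trans (∑-+ xs f (λ x → - g x)) (+-congˡ (∑-neg xs g))

  ∑-*ˡ : ∀ (xs : List T) (a : Carrier) (f : T → Carrier) → ∑ xs (λ x → a * f x) ≈ a * ∑ xs f
  ∑-*ˡ []       a f = sym (zeroʳ a)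
  ∑-*ˡ (x ∷ xs) a f = trans (+-congˡ (∑-*ˡ xs a f)) (sym (distribˡ _ _ _))

  ∑-comm : ∀ (xs : List T) (ys : List U) (h : T → U → Carrier) →
           ∑ ys (λ y → ∑ xs (λ x → h x y)) ≈ ∑ xs (λ x → ∑ ys (λ y → h x y))
  ∑-comm []       ys h = ∑-zero ys (λ _ → refl)
  ∑-comm (x ∷ xs) ys h = trans (∑-+ ys (h x) (λ y → ∑ xs (λ x → h x y))) (+-congˡ (∑-comm xs ys h))

¬¬-All : ∀ {P : T → Set} (xs : List T) → (∀ x → ¬ ¬ P x) → ¬ ¬ All P xs
¬¬-All xs ¬¬P = All.sequenceM _ ¬¬-Monad (All.tabulate (λ {x} _ → ¬¬P x))

record Disconnection {V : Set} (Λ : List V → Set) : Set₁ where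
  field
    Red           : V → Set
    Red?          : Decidable Red
    red blue      : V
    red-vertex    : Λ (red ∷ [])
    blue-vertex   : Λ (blue ∷ [])
    red-isRed     : Red red
    blue-notRed   : ¬ Red blue
    monochromatic : ∀ {u v} → Λ (u ∷ v ∷ []) → Red u ⇔ Red v

module _ {c ℓ : Level} (K : Field c ℓ) {V : Set} (enum : List V) where
  open Field K
  open import Algebra.Properties.Ring ring using (-0#≈0#; -‿distribʳ-*)
  open import Relation.Binary.Reasoning.Setoid setoid

  CountsEachOnce : Set (c ⊔ ℓ)
  CountsEachOnce = ∀ v (h : V → Carrier) → (∀ w → w ≢ v → h w ≈ 0#) → ∑ K enum h ≈ h v

  ∂-empty : ∀ ch → ∂ K enum ch [] ≈ ∑ K enum (λ v → ch (v ∷ []))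
  ∂-empty ch = sum-++[] K (map (λ v → ch (v ∷ [])) enum)

  ∂-vertex : ∀ d v → ∂ K enum d (v ∷ []) ≈
             ∑ K enum (λ u → d (u ∷ v ∷ [])) - ∑ K enum (λ u → d (v ∷ u ∷ []))
  ∂-vertex d v = trans (sum-++ K (map (λ u → d (u ∷ v ∷ [])) enum) _)
    (+-congˡ (trans (sum-++[] K (map (λ u → - d (v ∷ u ∷ [])) enum)) (∑-neg K enum _)))

  module _ {Λ : List V → Set} (edge⇒vertices : ∀ {u v} → Λ (u ∷ v ∷ []) → Λ (u ∷ []) × Λ (v ∷ []))
           (d : List V → Carrier) (d-supported : ∀ L → ¬ Λ L → d L ≈ 0#) where

    ∂-off-support : ∀ v → ¬ Λ (v ∷ []) → ∂ K enum d (v ∷ []) ≈ 0#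
    ∂-off-support v ¬Λv = begin
      ∂ K enum d (v ∷ [])
        ≈⟨ ∂-vertex d v ⟩
      ∑ K enum (λ u → d (u ∷ v ∷ [])) - ∑ K enum (λ u → d (v ∷ u ∷ []))
        ≈⟨ +-cong (∑-zero K enum (λ u → d-supported _ (¬Λv ∘ proj₂ ∘ edge⇒vertices)))
                  (-‿cong (∑-zero K enum (λ u → d-supported _ (¬Λv ∘ proj₁ ∘ edge⇒vertices)))) ⟩
      0# - 0#
        ≈⟨ -‿inverseʳ 0# ⟩
      0# ∎

    ∑-weighted-∂ : (w : V → Carrier) →
                   All (λ v → All (λ u → Dec (Λ (u ∷ v ∷ []))) enum) enum →
                   (∀ {u v} → Λ (u ∷ v ∷ []) → w u ≈ w v) →
                   ∑ K enum (λ v → w v * ∂ K enum d (v ∷ [])) ≈ 0#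
    ∑-weighted-∂ w edge? w-const = begin
      ∑ K enum (λ v → w v * ∂ K enum d (v ∷ []))
        ≈⟨ ∑-cong K enum (All.tabulate (λ {v} _ → trans (*-congˡ (∂-vertex d v)) (expand v))) ⟩
      ∑ K enum (λ v → in-weight v - out-weight v)
        ≈⟨ ∑-sub K enum in-weight out-weight ⟩
      ∑ K enum in-weight - ∑ K enum out-weight
        ≈⟨ +-congʳ (trans (∑-cong K enum (All.map (∑-cong K enum ∘ All.map move) edge?))
                          (∑-comm K enum enum (λ u v → w u * d (u ∷ v ∷ [])))) ⟩
      ∑ K enum out-weight - ∑ K enum out-weight
        ≈⟨ -‿inverseʳ _ ⟩
      0# ∎
      where
      in-weight out-weight : V → Carrier
      in-weight  v = ∑ K enum (λ u → w v * d (u ∷ v ∷ []))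
      out-weight v = ∑ K enum (λ u → w v * d (v ∷ u ∷ []))

      expand : ∀ v → w v * (∑ K enum (λ u → d (u ∷ v ∷ [])) - ∑ K enum (λ u → d (v ∷ u ∷ []))) ≈
                     in-weight v - out-weight v
      expand v = trans (distribˡ _ _ _)
        (+-cong (sym (∑-*ˡ K enum (w v) _))
                (trans (sym (-‿distribʳ-* _ _)) (-‿cong (sym (∑-*ˡ K enum (w v) _)))))

      move : ∀ {u v} → Dec (Λ (u ∷ v ∷ [])) → w v * d (u ∷ v ∷ []) ≈ w u * d (u ∷ v ∷ [])
      move (yes Λuv) = *-congʳ (sym (w-const Λuv))
      move {u} {v} (no ¬Λuv) = trans (*-congˡ d≈0) (trans (zeroʳ _) (sym (trans (*-congˡ d≈0) (zeroʳ _))))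
        where
        d≈0 : d (u ∷ v ∷ []) ≈ 0#
        d≈0 = d-supported _ ¬Λuv

  module _ (_≟ᵥ_ : DecidableEquality V) (countsEachOnce : CountsEachOnce) {Λ : List V → Set}
           (edge⇒vertices : ∀ {u v} → Λ (u ∷ v ∷ []) → Λ (u ∷ []) × Λ (v ∷ [])) where

    δ : V → V → Carrier
    δ v w = if does (w ≟ᵥ v) then 1# else 0#

    δ-≢ : ∀ {v w} → w ≢ v → δ v w ≈ 0#
    δ-≢ {v} {w} w≢v with w ≟ᵥ v
    ... | yes w≡v = contradiction w≡v w≢v
    ... | no  _   = refl

    δ-refl : ∀ v → δ v v ≈ 1#
    δ-refl v with v ≟ᵥ v
    ... | yes _   = refl
    ... | no  v≢v = contradiction ≡.refl v≢v

    ∑-δ : ∀ v → ∑ K enum (δ v) ≈ 1#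
    ∑-δ v = trans (countsEachOnce v (δ v) (λ _ → δ-≢)) (δ-refl v)

    ∑-*δ : ∀ (f : V → Carrier) v → ∑ K enum (λ w → f w * δ v w) ≈ f v
    ∑-*δ f v = trans (countsEachOnce v _ (λ _ w≢v → trans (*-congˡ (δ-≢ w≢v)) (zeroʳ _)))
                     (trans (*-congˡ (δ-refl v)) (*-identityʳ _))

    module _ (D : Disconnection Λ) where
      open Disconnection D

      separatingCycle : List V → Carrier
      separatingCycle (v ∷ []) = δ red v - δ blue v
      separatingCycle _        = 0#

      separatingCycle-supported : ∀ L → ¬ Λ L → separatingCycle L ≈ 0#
      separatingCycle-supported []          _   = refl
      separatingCycle-supported (v ∷ [])    ¬Λv =
        trans (+-cong (δ-≢ λ { ≡.refl → ¬Λv red-vertex }) (-‿cong (δ-≢ λ { ≡.refl → ¬Λv blue-vertex })))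
              (-‿inverseʳ 0#)
      separatingCycle-supported (_ ∷ _ ∷ _) _   = refl

      separatingCycle-isCycle : ∀ G → Λ G → suc (length G) ≡ 1 → ∂ K enum separatingCycle G ≈ 0#
      separatingCycle-isCycle [] _ _ = begin
        ∂ K enum separatingCycle []             ≈⟨ ∂-empty separatingCycle ⟩
        ∑ K enum (λ v → δ red v - δ blue v)     ≈⟨ ∑-sub K enum (δ red) (δ blue) ⟩
        ∑ K enum (δ red) - ∑ K enum (δ blue)    ≈⟨ +-cong (∑-δ red) (-‿cong (∑-δ blue)) ⟩
        1# - 1#                                 ≈⟨ -‿inverseʳ 1# ⟩
        0#                                      ∎

      weight : V → Carrier
      weight v = if does (Red? v) then 1# else 0#

      weight-const : ∀ {u v} → Λ (u ∷ v ∷ []) → weight u ≈ weight v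
      weight-const {u} {v} Λuv with Red? u | Red? v
      ... | yes _  | yes _  = refl
      ... | no  _  | no  _  = refl
      ... | yes ru | no ¬rv = contradiction (Equivalence.to (monochromatic Λuv) ru) ¬rv
      ... | no ¬ru | yes rv = contradiction (Equivalence.from (monochromatic Λuv) rv) ¬ru

      weight-red-blue : weight red - weight blue ≈ 1#
      weight-red-blue with Red? red | Red? blue
      ... | yes _    | no _   = trans (+-congˡ -0#≈0#) (+-identityʳ 1#)
      ... | no ¬rred | _      = contradiction red-isRed ¬rred
      ... | _        | yes rb = contradiction rb blue-notRed

      ∑-weighted-separatingCycle : ∑ K enum (λ v → weight v * separatingCycle (v ∷ [])) ≈ 1#
      ∑-weighted-separatingCycle = begin
        ∑ K enum (λ v → weight v * (δ red v - δ blue v))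
          ≈⟨ ∑-cong K enum (All.tabulate λ _ → trans (distribˡ _ _ _) (+-congˡ (sym (-‿distribʳ-* _ _)))) ⟩
        ∑ K enum (λ v → weight v * δ red v - weight v * δ blue v)
          ≈⟨ ∑-sub K enum _ _ ⟩
        ∑ K enum (λ v → weight v * δ red v) - ∑ K enum (λ v → weight v * δ blue v)
          ≈⟨ +-cong (∑-*δ weight red) (-‿cong (∑-*δ weight blue)) ⟩
        weight red - weight blue
          ≈⟨ weight-red-blue ⟩
        1# ∎

      -- Λ need not be decidable, but the goal is ⊥, so we may decide it on the finitely many
      -- vertices and edges over enum.
      disconnected⇒¬H̃₀-vanishes : ¬ ReducedHomologyVanishes K enum Λ 1
      disconnected⇒¬H̃₀-vanishes vanishes =
        ¬¬-All enum (λ _ → ¬¬-excluded-middle) λ vertex? →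
        ¬¬-All enum (λ _ → ¬¬-All enum (λ _ → ¬¬-excluded-middle)) λ edge? →
        1≉0 (begin
          1#                                                   ≈⟨ ∑-weighted-separatingCycle ⟨
          ∑ K enum (λ v → weight v * separatingCycle (v ∷ [])) ≈⟨ ∑-cong K enum (All.map weighted-∂d≈cycle vertex?) ⟨
          ∑ K enum (λ v → weight v * ∂ K enum d (v ∷ []))      ≈⟨ ∑-weighted-∂ edge⇒vertices d d-supported
                                                                   weight edge? weight-const ⟩
          0#                                                   ∎)
        where
        d : List V → Carrier
        d = proj₁ (vanishes separatingCycle separatingCycle-supported separatingCycle-isCycle)

        d-supported : ∀ L → ¬ Λ L → d L ≈ 0#
        d-supported = proj₁ (proj₂ (vanishes separatingCycle separatingCycle-supported separatingCycle-isCycle))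

        d-bounds : ∀ G → Λ G → length G ≡ 1 → ∂ K enum d G ≈ separatingCycle G
        d-bounds = proj₂ (proj₂ (vanishes separatingCycle separatingCycle-supported separatingCycle-isCycle))

        weighted-∂d≈cycle : ∀ {v} → Dec (Λ (v ∷ [])) →
                            weight v * ∂ K enum d (v ∷ []) ≈ weight v * separatingCycle (v ∷ [])
        weighted-∂d≈cycle {v} (yes Λv) = *-congˡ (d-bounds (v ∷ []) Λv ≡.refl)
        weighted-∂d≈cycle {v} (no ¬Λv) = *-congˡ (trans (∂-off-support edge⇒vertices d d-supported v ¬Λv)
                                                        (sym (separatingCycle-supported (v ∷ []) ¬Λv)))

module _ {c ℓ : Level} (K : Field c ℓ) where
  open Field K
  open import Relation.Binary.Reasoning.Setoid setoid

  ∑-allSubsets-suc : ∀ n (h : Subset (suc n) → Carrier) →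
    ∑ K (allSubsets (suc n)) h ≈
    ∑ K (allSubsets n) (h ∘ (inside ∷_)) + ∑ K (allSubsets n) (h ∘ (outside ∷_))
  ∑-allSubsets-suc n h =
    trans (∑-++ K (map (inside ∷_) (allSubsets n)) (map (outside ∷_) (allSubsets n)) h)
          (reflexive (≡.cong₂ _+_ (∑-map K _ (allSubsets n) h) (∑-map K _ (allSubsets n) h)))

  allSubsets-countsEachOnce : ∀ n → CountsEachOnce K (allSubsets n)
  allSubsets-countsEachOnce zero    []           h _   = +-identityʳ _
  allSubsets-countsEachOnce (suc n) (inside ∷ v) h h≈0 = begin
    ∑ K (allSubsets (suc n)) h
      ≈⟨ ∑-allSubsets-suc n h ⟩
    ∑ K (allSubsets n) (h ∘ (inside ∷_)) + ∑ K (allSubsets n) (h ∘ (outside ∷_))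
      ≈⟨ +-cong (allSubsets-countsEachOnce n v _ (λ w w≢v → h≈0 _ (w≢v ∘ ∷-injectiveʳ)))
                (∑-zero K (allSubsets n) (λ w → h≈0 _ λ ())) ⟩
    h (inside ∷ v) + 0#
      ≈⟨ +-identityʳ _ ⟩
    h (inside ∷ v) ∎
  allSubsets-countsEachOnce (suc n) (outside ∷ v) h h≈0 = begin
    ∑ K (allSubsets (suc n)) h
      ≈⟨ ∑-allSubsets-suc n h ⟩
    ∑ K (allSubsets n) (h ∘ (inside ∷_)) + ∑ K (allSubsets n) (h ∘ (outside ∷_))
      ≈⟨ +-cong (∑-zero K (allSubsets n) (λ w → h≈0 _ λ ()))
                (allSubsets-countsEachOnce n v _ (λ w w≢v → h≈0 _ (w≢v ∘ ∷-injectiveʳ))) ⟩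
    0# + h (outside ∷ v)
      ≈⟨ +-identityˡ _ ⟩
    h (outside ∷ v) ∎

-- Opened only here: above, refl, sym and trans are those of the field's setoid.
open ≡ using (refl; sym; trans; cong; subst)

Disjoint : Subset n → Subset n → Set
Disjoint p q = ∀ {x} → x ∈ p → x ∉ q

Empty∩⇒Disjoint : Empty (p ∩ q) → Disjoint p q
Empty∩⇒Disjoint p∩q=∅ x∈p x∈q = p∩q=∅ (_ , x∈p∩q⁺ (x∈p , x∈q))

⊈⇒∃∉ : ¬ (p ⊆ q) → ∃[ x ] (x ∈ p × x ∉ q)
⊈⇒∃∉ {n} {p} {q} p⊈q with ¬∀⟶∃¬ n (λ x → x ∈ p → x ∈ q) (λ x → x ∈? p →-dec x ∈? q) (λ p→q → p⊈q (p→q _))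
... | x , ¬p→q = x , decidable-stable (x ∈? p) (λ x∉p → ¬p→q (λ x∈p → contradiction x∈p x∉p)) , ¬p→q ∘ const

⊆∧≢⇒⊂ : p ⊆ q → p ≢ q → p ⊂ q
⊆∧≢⇒⊂ p⊆q p≢q = p⊆q , ⊈⇒∃∉ (p≢q ∘ ⊆-antisym p⊆q)

x∈p─q⇒x∉q : x ∈ p ─ q → x ∉ q
x∈p─q⇒x∉q {p = _ ∷ _} {q = outside ∷ _} here          ()
x∈p─q⇒x∉q {p = _ ∷ _} {q = _ ∷ _}       (there x∈p─q) (there x∈q) = x∈p─q⇒x∉q x∈p─q x∈q

x∉p─⁅x⁆ : x ∉ p ─ ⁅ x ⁆
x∉p─⁅x⁆ {x = x} x∈p─x = x∈p─q⇒x∉q x∈p─x (x∈⁅x⁆ x)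

─-mono : ∀ {p′ q′ : Subset n} → p ⊆ p′ → q′ ⊆ q → p ─ q ⊆ p′ ─ q′
─-mono {p = p} {q = q} p⊆p′ q′⊆q x∈p─q =
  x∈p∧x∉q⇒x∈p─q (p⊆p′ (p─q⊆p p q x∈p─q)) (x∈p─q⇒x∉q x∈p─q ∘ q′⊆q)

p⊆p─⊥ : p ⊆ p ─ ⊥
p⊆p─⊥ x∈p = x∈p∧x∉q⇒x∈p─q x∈p ∉⊥

⁅x⁆⊆p : x ∈ p → ⁅ x ⁆ ⊆ p
⁅x⁆⊆p {p = p} x∈p y∈⁅x⁆ = subst (_∈ p) (sym (x∈⁅y⁆⇒x≡y _ y∈⁅x⁆)) x∈p

∈⇒⊥⊂ : x ∈ p → ⊥ ⊂ p
∈⇒⊥⊂ x∈p = ⊥⊆ , _ , x∈p , ∉⊥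

∣s∷p∣≤1+∣p∣ : ∀ s (p : Subset n) → ∣ s ∷ p ∣ ≤ suc ∣ p ∣
∣s∷p∣≤1+∣p∣ inside  p = ℕ.≤-refl
∣s∷p∣≤1+∣p∣ outside p = ℕ.n≤1+n ∣ p ∣

∣p∣≤1+∣p─⁅x⁆∣ : ∀ (p : Subset n) x → ∣ p ∣ ≤ suc ∣ p ─ ⁅ x ⁆ ∣
∣p∣≤1+∣p─⁅x⁆∣ (s       ∷ p) zero    = subst (λ r → ∣ s ∷ p ∣ ≤ suc ∣ r ∣) (sym (p─⊥≡p p)) (∣s∷p∣≤1+∣p∣ s p)
∣p∣≤1+∣p─⁅x⁆∣ (inside  ∷ p) (suc x) = s≤s (∣p∣≤1+∣p─⁅x⁆∣ p x)
∣p∣≤1+∣p─⁅x⁆∣ (outside ∷ p) (suc x) = ∣p∣≤1+∣p─⁅x⁆∣ p x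

∃-∉ : ∀ (p : Subset n) (xs : List (Fin n)) → length xs < ∣ p ∣ → ∃[ x ] (x ∈ p × x ∉ₗ xs)
∃-∉ {n} p [] 0<∣p∣
  with decidable-stable (nonempty? p)
         (λ p-empty → ℕ.<-irrefl (sym (∣⊥∣≡0 n)) (subst (λ r → 0 < ∣ r ∣) (Empty-unique p-empty) 0<∣p∣))
... | x , x∈p = x , x∈p , λ ()
∃-∉ p (y ∷ ys) ∣y∷ys∣<∣p∣ with ∃-∉ (p ─ ⁅ y ⁆) ys (ℕ.≤-pred (ℕ.≤-trans ∣y∷ys∣<∣p∣ (∣p∣≤1+∣p─⁅x⁆∣ p y)))
... | x , x∈p─y , x∉ys = x , p─q⊆p p _ x∈p─y , λ where
  (Any.here refl)  → x∉p─⁅x⁆ x∈p─y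
  (Any.there x∈ys) → x∉ys x∈ys

Unique⇒length≤∣p∣ : ∀ {xs : List (Fin n)} → Unique xs → All (_∈ p) xs → length xs ≤ ∣ p ∣
Unique⇒length≤∣p∣ []            []           = z≤n
Unique⇒length≤∣p∣ (x≢xs ∷ uniq) (x∈p ∷ xs⊆p) =
  ℕ.≤-<-trans (Unique⇒length≤∣p∣ uniq (All.zipWith (λ (y∈p , x≢y) → x∈p∧x≢y⇒x∈p-y y∈p (x≢y ∘ sym)) (xs⊆p , x≢xs)))
              (x∈p⇒∣p-x∣<∣p∣ x∈p)

-- Chains and faces of the coloring complex

ChainFrom-lower : p ⊂ A → ChainFrom A L → ChainFrom p L
ChainFrom-lower {L = []}    p⊂A A⊂⊤         = ⊂-trans p⊂A A⊂⊤
ChainFrom-lower {L = _ ∷ _} p⊂A (A⊂B , chain) = ⊂-trans p⊂A A⊂B , chain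

ChainFrom-above : ChainFrom p L → X ∈ₗ L → p ⊂ X
ChainFrom-above {L = _ ∷ L} (p⊂A , _)     (Any.here refl) = p⊂A
ChainFrom-above {L = _ ∷ L} (p⊂A , chain) (Any.there X∈L) = ⊂-trans p⊂A (ChainFrom-above chain X∈L)

ChainFrom⇒⊂⊤ : ChainFrom p L → p ⊂ ⊤
ChainFrom⇒⊂⊤ {L = []}    p⊂⊤           = p⊂⊤
ChainFrom⇒⊂⊤ {L = _ ∷ _} (p⊂A , chain) = ⊂-trans p⊂A (ChainFrom⇒⊂⊤ chain)

ChainFrom-⊂⊤ : ChainFrom p L → X ∈ₗ L → X ⊂ ⊤
ChainFrom-⊂⊤ (_ , chain) (Any.here refl) = ChainFrom⇒⊂⊤ chain
ChainFrom-⊂⊤ (_ , chain) (Any.there X∈L) = ChainFrom-⊂⊤ chain X∈L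

Comparable : Subset n → Subset n → Set
Comparable X Y = X ⊆ Y ⊎ Y ⊆ X

ChainFrom-comparable : ChainFrom p L → X ∈ₗ L → Y ∈ₗ L → Comparable X Y
ChainFrom-comparable _           (Any.here refl) (Any.here refl) = inj₁ id
ChainFrom-comparable (_ , chain) (Any.here refl) (Any.there Y∈L) = inj₁ (proj₁ (ChainFrom-above chain Y∈L))
ChainFrom-comparable (_ , chain) (Any.there X∈L) (Any.here refl) = inj₂ (proj₁ (ChainFrom-above chain X∈L))
ChainFrom-comparable (_ , chain) (Any.there X∈L) (Any.there Y∈L) = ChainFrom-comparable chain X∈L Y∈L

module _ {P : Pred (Subset n) 0ℓ} (P? : Decidable P) where

  ChainFrom-filter : ChainFrom p L → ChainFrom p (filter P? L)
  ChainFrom-filter {L = []}    p⊂⊤           = p⊂⊤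
  ChainFrom-filter {L = A ∷ L} (p⊂A , chain) with does (P? A)
  ... | true  = p⊂A , ChainFrom-filter chain
  ... | false = ChainFrom-filter (ChainFrom-lower p⊂A chain)

ChainFrom⊆ : Subset n → List (Subset n) → Set
ChainFrom⊆ q []      = q ⊆ ⊤
ChainFrom⊆ q (A ∷ L) = q ⊆ A × ChainFrom A L

ChainFrom⇒ChainFrom⊆ : ChainFrom p L → ChainFrom⊆ p L
ChainFrom⇒ChainFrom⊆ {L = []}    p⊂⊤           = proj₁ p⊂⊤
ChainFrom⇒ChainFrom⊆ {L = _ ∷ _} (p⊂A , chain) = proj₁ p⊂A , chain

ChainFrom⊆⇒ChainFrom : p ⊂ q → ChainFrom⊆ q L → ChainFrom p L
ChainFrom⊆⇒ChainFrom {L = []}    p⊂q q⊆⊤           = ⊂-⊆-trans p⊂q q⊆⊤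
ChainFrom⊆⇒ChainFrom {L = _ ∷ _} p⊂q (q⊆A , chain) = ⊂-⊆-trans p⊂q q⊆A , chain

ChainFrom⊆-above : ChainFrom⊆ q L → X ∈ₗ L → q ⊆ X
ChainFrom⊆-above (q⊆A , _)     (Any.here refl) = q⊆A
ChainFrom⊆-above (q⊆A , chain) (Any.there X∈L) = ⊆-trans q⊆A (proj₁ (ChainFrom-above chain X∈L))

Unsplit : Subset n → Subset n → Set
Unsplit f X = f ⊆ X ⊎ Disjoint f X

unsplit-below⇒⊂ : ∀ {u} → Unsplit f u → ⊥ ⊂ u → u ⊂ X → f ⊆ X → f ⊂ X
unsplit-below⇒⊂ (inj₁ f⊆u)    _                   u⊂X _   = ⊆-⊂-trans f⊆u u⊂X
unsplit-below⇒⊂ (inj₂ f∩u=∅) (_ , a , a∈u , _) u⊂X f⊆X = f⊆X , a , proj₁ u⊂X a∈u , λ a∈f → f∩u=∅ a∈f a∈u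

module _ {n : ℕ} (E : List (Subset n)) where

  EdgeGap-lower : p ⊆ A → EdgeGap E A L → EdgeGap E p L
  EdgeGap-lower {L = []}    p⊆A (f , f∈E , f⊆⊤─A)      = f , f∈E , ─-mono id p⊆A ∘ f⊆⊤─A
  EdgeGap-lower {L = _ ∷ _} p⊆A (inj₁ (f , f∈E , f⊆B─A)) = inj₁ (f , f∈E , ─-mono id p⊆A ∘ f⊆B─A)
  EdgeGap-lower {L = _ ∷ _} p⊆A (inj₂ gap)              = inj₂ gap

  EdgeGap-first : ChainFrom⊆ A L → f ∈ₗ E → f ⊆ A ─ p → EdgeGap E p L
  EdgeGap-first {L = []}    A⊆⊤       f∈E f⊆A─p = _ , f∈E , ─-mono A⊆⊤ id ∘ f⊆A─p
  EdgeGap-first {L = _ ∷ _} (A⊆B , _) f∈E f⊆A─p = inj₁ (_ , f∈E , ─-mono A⊆B id ∘ f⊆A─p)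

  module _ {P : Pred (Subset n) 0ℓ} (P? : Decidable P) where

    EdgeGap-filter : ChainFrom p L → EdgeGap E p L → EdgeGap E p (filter P? L)
    EdgeGap-filter {L = []}    _             gap = gap
    EdgeGap-filter {L = A ∷ L} (p⊂A , chain) gap with does (P? A) | gap
    ... | true  | inj₁ edge          = inj₁ edge
    ... | true  | inj₂ gap′          = inj₂ (EdgeGap-filter chain gap′)
    ... | false | inj₁ (_ , f∈E , f⊆A─p) =
      EdgeGap-filter (ChainFrom-lower p⊂A chain) (EdgeGap-first (ChainFrom⇒ChainFrom⊆ chain) f∈E f⊆A─p)
    ... | false | inj₂ gap′ =
      EdgeGap-filter (ChainFrom-lower p⊂A chain) (EdgeGap-lower (proj₁ p⊂A) gap′)

  face⇒unsplitEdge : ChainFrom p L → EdgeGap E p L →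
                     ∃[ f ] (f ∈ₗ E × Disjoint f p × ∀ {X} → X ∈ₗ L → Unsplit f X)
  face⇒unsplitEdge {L = []} _ (f , f∈E , f⊆⊤─p) = f , f∈E , x∈p─q⇒x∉q ∘ f⊆⊤─p , λ ()
  face⇒unsplitEdge {L = A ∷ L} (p⊂A , chain) (inj₁ (f , f∈E , f⊆A─p)) =
    f , f∈E , x∈p─q⇒x∉q ∘ f⊆A─p , λ where
      (Any.here refl)  → inj₁ f⊆A
      (Any.there X∈L) → inj₁ (proj₁ (ChainFrom-above chain X∈L) ∘ f⊆A)
    where
    f⊆A : f ⊆ A
    f⊆A = p─q⊆p _ _ ∘ f⊆A─p
  face⇒unsplitEdge {L = A ∷ L} (p⊂A , chain) (inj₂ gap) with face⇒unsplitEdge chain gap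
  ... | f , f∈E , f∩A=∅ , unsplit = f , f∈E , (λ x∈f → f∩A=∅ x∈f ∘ proj₁ p⊂A) , λ where
    (Any.here refl)  → inj₂ f∩A=∅
    (Any.there X∈L) → unsplit X∈L

-- Maximal chains above a set

-- The chain B ⊊ B ∪ {i₁} ⊊ B ∪ {i₁, i₂} ⊊ ⋯ ⊊ ⊤ ─ {iₘ} adding the elements i₁ < ⋯ < iₘ missing
-- from B one at a time (empty when B = ⊤).
saturate : Subset n → List (Subset n)
saturate []            = []
saturate (inside  ∷ B) = map (inside ∷_) (saturate B)
saturate (outside ∷ B) = (outside ∷ B) ∷ map (inside ∷_) (saturate B)

∷⊆inside∷ : p ⊆ q → s ∷ p ⊆ inside ∷ q
∷⊆inside∷ {s = inside}  = s⊆s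
∷⊆inside∷ {s = outside} = out⊆

∷⊂inside∷ : p ⊂ q → s ∷ p ⊂ inside ∷ q
∷⊂inside∷ {s = inside}  = s⊂s
∷⊂inside∷ {s = outside} = out⊂

ChainFrom-map-inside : ChainFrom p L → ChainFrom (s ∷ p) (map (inside ∷_) L)
ChainFrom-map-inside {L = []}    p⊂⊤           = ∷⊂inside∷ p⊂⊤
ChainFrom-map-inside {L = _ ∷ _} (p⊂A , chain) = ∷⊂inside∷ p⊂A , ChainFrom-map-inside chain

ChainFrom⊆-map-inside : ChainFrom⊆ p L → ChainFrom⊆ (s ∷ p) (map (inside ∷_) L)
ChainFrom⊆-map-inside {L = []}    _             = ⊆⊤
ChainFrom⊆-map-inside {L = _ ∷ _} (p⊆A , chain) = ∷⊆inside∷ p⊆A , ChainFrom-map-inside chain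

saturate-chain⊆ : ∀ (B : Subset n) → ChainFrom⊆ B (saturate B)
saturate-chain⊆ []            = ⊆⊤
saturate-chain⊆ (inside  ∷ B) = ChainFrom⊆-map-inside (saturate-chain⊆ B)
saturate-chain⊆ (outside ∷ B) with saturate B | saturate-chain⊆ B
... | []    | B⊆⊤           = id , out⊂in B⊆⊤
... | _ ∷ _ | (B⊆A , chain) = id , out⊂in B⊆A , ChainFrom-map-inside chain

saturate-chain : p ⊂ B → ChainFrom p (saturate B)
saturate-chain {B = B} p⊂B = ChainFrom⊆⇒ChainFrom p⊂B (saturate-chain⊆ B)

saturate-⊇ : X ∈ₗ saturate B → B ⊆ X
saturate-⊇ {B = B} = ChainFrom⊆-above (saturate-chain⊆ B)

∉⇒∈saturate : ∀ {x} → x ∉ B → B ∈ₗ saturate B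
∉⇒∈saturate {B = inside  ∷ B} {zero}  x∉B = contradiction here x∉B
∉⇒∈saturate {B = inside  ∷ B} {suc x} x∉B = ∈-map⁺ (inside ∷_) (∉⇒∈saturate (x∉B ∘ there))
∉⇒∈saturate {B = outside ∷ B}         _   = Any.here refl

inside∷-∈saturate : ∀ s (B : Subset n) → X ∈ₗ saturate B → inside ∷ X ∈ₗ saturate (s ∷ B)
inside∷-∈saturate inside  _ = ∈-map⁺ (inside ∷_)
inside∷-∈saturate outside _ = Any.there ∘ ∈-map⁺ (inside ∷_)

Splits : Subset n → Fin n → Fin n → Set
Splits X x y = (x ∈ X × y ∉ X) ⊎ (y ∈ X × x ∉ X)

saturate-splits : ∀ {x y} → x ∉ B → y ∉ B → x ≢ y → ∃[ X ] (X ∈ₗ saturate B × Splits X x y)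
saturate-splits {B = inside ∷ B} {zero}         x∉B _   _ = contradiction here x∉B
saturate-splits {B = inside ∷ B} {suc _} {zero} _   y∉B _ = contradiction here y∉B
saturate-splits {B = s ∷ B} {suc x} {suc y} x∉B y∉B x≢y
  with saturate-splits (x∉B ∘ there) (y∉B ∘ there) (x≢y ∘ cong suc)
... | X , X∈sat , split = inside ∷ X , inside∷-∈saturate s B X∈sat , Sum.map lift lift split
  where
  lift : ∀ {a b} → a ∈ X × b ∉ X → suc a ∈ inside ∷ X × suc b ∉ inside ∷ X
  lift (a∈X , b∉X) = there a∈X , b∉X ∘ drop-there
saturate-splits {B = outside ∷ B} {zero} {zero}  _ _   x≢y = contradiction refl x≢y
saturate-splits {B = outside ∷ B} {zero} {suc y} _ y∉B _   =
  inside ∷ B , inside∷-∈saturate outside B (∉⇒∈saturate (y∉B ∘ there)) , inj₁ (here , y∉B ∘ there ∘ drop-there)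
saturate-splits {B = outside ∷ B} {suc x} {zero} x∉B _ _   =
  inside ∷ B , inside∷-∈saturate outside B (∉⇒∈saturate (x∉B ∘ there)) , inj₂ (here , x∉B ∘ there ∘ drop-there)

saturate-maximal : ∀ {j} → B ⊆ Y → j ∉ Y → (∀ {X} → X ∈ₗ saturate B → Comparable X Y) → Y ∈ₗ saturate B
saturate-maximal {B = []} {j = ()}
saturate-maximal {B = inside ∷ _} {Y = outside ∷ _} B⊆Y _ _ = contradiction (B⊆Y here) λ ()
saturate-maximal {B = s ∷ B} {Y = inside ∷ Y} {j = zero}  _ j∉Y _ = contradiction here j∉Y
saturate-maximal {B = s ∷ B} {Y = inside ∷ Y} {j = suc j} B⊆Y j∉Y comparable =
  inside∷-∈saturate s B (saturate-maximal (drop-∷-⊆ B⊆Y) (j∉Y ∘ there)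
    (Sum.map drop-∷-⊆ drop-∷-⊆ ∘ comparable ∘ inside∷-∈saturate s B))
saturate-maximal {B = outside ∷ B} {Y = outside ∷ Y} B⊆Y _ comparable =
  Any.here (cong (outside ∷_) (⊆-antisym Y⊆B (drop-∷-⊆ B⊆Y)))
  where
  Y⊆B : Y ⊆ B
  Y⊆B {x} x∈Y = decidable-stable (x ∈? B) λ x∉B →
    [ (λ inB⊆outY → contradiction (inB⊆outY here) λ ()) , (λ outY⊆inB → x∉B (drop-there (outY⊆inB (there x∈Y)))) ]′
    (comparable (inside∷-∈saturate outside B (∉⇒∈saturate x∉B)))

unsplit-saturate⇒⊆ : (∀ {X} → X ∈ₗ saturate B → Unsplit f X) → 2 ≤ ∣ f ∣ → f ⊆ B
unsplit-saturate⇒⊆ {B = B} {f = f} unsplit 2≤∣f∣ {x} x∈f = decidable-stable (x ∈? B) λ x∉B →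
  [ (λ f⊆B → x∉B (f⊆B x∈f)) , (λ (f∩B=∅ : Disjoint f B) → meets-B x∉B f∩B=∅) ]′ (unsplit (∉⇒∈saturate x∉B))
  where
  meets-B : x ∉ B → ¬ Disjoint f B
  meets-B x∉B f∩B=∅ with ∃-∉ f (x ∷ []) 2≤∣f∣
  ... | y , y∈f , y∉[x] with saturate-splits x∉B (f∩B=∅ y∈f) (y∉[x] ∘ Any.here ∘ sym)
  ... | X , X∈sat , split with unsplit X∈sat | split
  ... | inj₁ f⊆X    | inj₁ (_ , y∉X)    = y∉X (f⊆X y∈f)
  ... | inj₁ f⊆X    | inj₂ (_ , x∉X)    = x∉X (f⊆X x∈f)
  ... | inj₂ f∩X=∅ | inj₁ (x∈X , _)    = f∩X=∅ x∈f x∈X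
  ... | inj₂ f∩X=∅ | inj₂ (y∈X , _)    = f∩X=∅ y∈f y∈X

below-saturate : ∀ {w} → (∀ {X} → X ∈ₗ saturate B → Comparable X w) → w ∉ₗ saturate B → w ⊂ ⊤ → w ⊂ B
below-saturate {B = B} {w} comparable w∉sat (_ , j , _ , j∉w) = ⊆∧≢⇒⊂ w⊆B w≢B
  where
  w≢B : w ≢ B
  w≢B refl = w∉sat (saturate-maximal id j∉w comparable)
  w⊆B : w ⊆ B
  w⊆B {x} x∈w = decidable-stable (x ∈? B) λ x∉B →
    [ (λ (B⊆w : B ⊆ w) → w∉sat (saturate-maximal B⊆w j∉w comparable)) , (λ (w⊆B : w ⊆ B) → x∉B (w⊆B x∈w)) ]′
    (comparable (∉⇒∈saturate x∉B))

-- Links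

_≟ˢ_ : ∀ {n} → DecidableEquality (Subset n)
_≟ˢ_ = ≡-dec Bool._≟_

module _ {c ℓ : Level} (K : Field c ℓ) {n : ℕ} (E : List (Subset n)) where

  Link : List (Subset n) → List (Subset n) → Set
  Link = LinkFace K (allSubsets n) _⊂_ (ColoringFace E)

  Link-intro : ∀ xs G ys → Linked _⊂_ G → (∀ X → X ∈ₗ G → X ∉ₗ xs ++ ys) →
               ColoringFace E (xs ++ G ++ ys) → Link (xs ++ ys) G
  Link-intro xs G ys linked G∉F face = linked , G∉F , xs ++ G ++ ys , face , λ X → mk⇔ to from
    where
    to : ∀ {X} → X ∈ₗ xs ++ G ++ ys → X ∈ₗ G ⊎ X ∈ₗ xs ++ ys
    to X∈L with ∈-++⁻ xs X∈L
    ... | inj₁ X∈xs = inj₂ (∈-++⁺ˡ X∈xs)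
    ... | inj₂ X∈G++ys = Sum.map₂ (∈-++⁺ʳ xs) (∈-++⁻ G X∈G++ys)
    from : ∀ {X} → X ∈ₗ G ⊎ X ∈ₗ xs ++ ys → X ∈ₗ xs ++ G ++ ys
    from (inj₁ X∈G) = ∈-++⁺ʳ xs (∈-++⁺ˡ X∈G)
    from (inj₂ X∈xs++ys) with ∈-++⁻ xs X∈xs++ys
    ... | inj₁ X∈xs = ∈-++⁺ˡ X∈xs
    ... | inj₂ X∈ys = ∈-++⁺ʳ xs (∈-++⁺ʳ G X∈ys)

  Link-edge⇒vertices : ∀ {F u v} → Link F (u ∷ v ∷ []) → Link F (u ∷ []) × Link F (v ∷ [])
  Link-edge⇒vertices {F} {u} {v} ((u⊂v ∷ [-]) , uv∉F , L , (chain , gap) , members) =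
    keep (Any.here refl) (Any.there (Any.here refl)) u≢v (λ where
      (Any.here refl)             _   → refl
      (Any.there (Any.here refl)) v≢v → contradiction refl v≢v) ,
    keep (Any.there (Any.here refl)) (Any.here refl) (u≢v ∘ sym) (λ where
      (Any.here refl)             u≢u → contradiction refl u≢u
      (Any.there (Any.here refl)) _   → refl)
    where
    u≢v : u ≢ v
    u≢v refl = ⊂-irref refl u⊂v

    keep : ∀ {r w} → r ∈ₗ u ∷ v ∷ [] → w ∈ₗ u ∷ v ∷ [] → r ≢ w →
           (∀ {X} → X ∈ₗ u ∷ v ∷ [] → X ≢ w → X ≡ r) → Link F (r ∷ [])
    keep {r} {w} r∈uv w∈uv r≢w only-r =
      [-] , (λ { _ (Any.here refl) → uv∉F r r∈uv }) ,
      filter ≢w? L , (ChainFrom-filter ≢w? chain , EdgeGap-filter E ≢w? chain gap) ,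
      λ X → mk⇔ to from
      where
      ≢w? : Decidable (_≢ w)
      ≢w? X = ¬? (X ≟ˢ w)
      to : ∀ {X} → X ∈ₗ filter ≢w? L → X ∈ₗ r ∷ [] ⊎ X ∈ₗ F
      to X∈L′ with ∈-filter⁻ ≢w? X∈L′
      ... | X∈L , X≢w = Sum.map₁ (λ X∈uv → Any.here (only-r X∈uv X≢w)) (Equivalence.to (members _) X∈L)
      from : ∀ {X} → X ∈ₗ r ∷ [] ⊎ X ∈ₗ F → X ∈ₗ filter ≢w? L
      from (inj₁ (Any.here refl)) = ∈-filter⁺ ≢w? (Equivalence.from (members _) (inj₁ r∈uv)) r≢w
      from (inj₂ X∈F) = ∈-filter⁺ ≢w? (Equivalence.from (members _) (inj₂ X∈F)) λ { refl → uv∉F w w∈uv X∈F }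

  module LinkEdge {F : List (Subset n)} {u v : Subset n} (uv : Link F (u ∷ v ∷ [])) where

    u⊂v : u ⊂ v
    u⊂v = Linked.head (proj₁ uv)

    u∉F : u ∉ₗ F
    u∉F = proj₁ (proj₂ uv) u (Any.here refl)

    v∉F : v ∉ₗ F
    v∉F = proj₁ (proj₂ uv) v (Any.there (Any.here refl))

    private
      witness : List (Subset n)
      witness = proj₁ (proj₂ (proj₂ uv))

      chain : ChainFrom ⊥ witness
      chain = proj₁ (proj₁ (proj₂ (proj₂ (proj₂ uv))))

      gap : EdgeGap E ⊥ witness
      gap = proj₂ (proj₁ (proj₂ (proj₂ (proj₂ uv))))

      ∈witness : ∀ {X} → X ∈ₗ u ∷ v ∷ [] ⊎ X ∈ₗ F → X ∈ₗ witness
      ∈witness = Equivalence.from (proj₂ (proj₂ (proj₂ (proj₂ uv))) _)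

      u∈witness : u ∈ₗ witness
      u∈witness = ∈witness (inj₁ (Any.here refl))

      v∈witness : v ∈ₗ witness
      v∈witness = ∈witness (inj₁ (Any.there (Any.here refl)))

      unsplitEdge : ∃[ f ] (f ∈ₗ E × Disjoint f ⊥ × ∀ {X} → X ∈ₗ witness → Unsplit f X)
      unsplitEdge = face⇒unsplitEdge E chain gap

    ⊥⊂u : ⊥ ⊂ u
    ⊥⊂u = ChainFrom-above chain u∈witness

    v⊂⊤ : v ⊂ ⊤
    v⊂⊤ = ChainFrom-⊂⊤ chain v∈witness

    comparable-v : ∀ {X} → X ∈ₗ F → Comparable X v
    comparable-v X∈F = ChainFrom-comparable chain (∈witness (inj₂ X∈F)) v∈witness

    edge : Subset n
    edge = proj₁ unsplitEdge

    edge∈E : edge ∈ₗ E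
    edge∈E = proj₁ (proj₂ unsplitEdge)

    unsplit-u : Unsplit edge u
    unsplit-u = proj₂ (proj₂ (proj₂ unsplitEdge)) u∈witness

    unsplit-v : Unsplit edge v
    unsplit-v = proj₂ (proj₂ (proj₂ unsplitEdge)) v∈witness

    unsplit-F : ∀ {X} → X ∈ₗ F → Unsplit edge X
    unsplit-F X∈F = proj₂ (proj₂ (proj₂ unsplitEdge)) (∈witness (inj₂ X∈F))

  record DisconnectedLink : Set₁ where
    field
      face          : List (Subset n)
      isFace        : ColoringFace E face
      {u v}         : Subset n
      link-edge     : Link face (u ∷ v ∷ [])
      disconnection : Disconnection (Link face)

  disconnectedLink⇒¬CohenMacaulay : DisconnectedLink → ¬ CohenMacaulay K (allSubsets n) _⊂_ (ColoringFace E)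
  disconnectedLink⇒¬CohenMacaulay D cm =
    disconnected⇒¬H̃₀-vanishes K (allSubsets n) _≟ˢ_ (allSubsets-countsEachOnce K n) Link-edge⇒vertices
      disconnection (cm face isFace 1 (_ , link-edge , s≤s (s≤s z≤n)))
    where open DisconnectedLink D

-- The two configurations

module _ {c ℓ : Level} (K : Field c ℓ) {n : ℕ} (E : List (Subset n))
         (sizes : ∀ e → e ∈ₗ E → 2 ≤ ∣ e ∣) (antichain : ∀ e e′ → e ∈ₗ E → e′ ∈ₗ E → ¬ (e ⊂ e′)) where

  module LargeDisjointEdges
      {e₁ e₂ : Subset n} (e₁∈E : e₁ ∈ₗ E) (e₂∈E : e₂ ∈ₗ E) (e₁∩e₂=∅ : Disjoint e₁ e₂)
      {x y w z z′ : Fin n} (x∈e₁ : x ∈ e₁) (y∈e₁ : y ∈ e₁) (w∈e₁ : w ∈ e₁) (z∈e₂ : z ∈ e₂) (z′∈e₂ : z′ ∈ e₂)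
      (y≢x : y ≢ x) (w≢x : w ≢ x) (w≢y : w ≢ y) (z≢z′ : z ≢ z′) where

    G : Subset n
    G = e₁ ∪ e₂

    F : List (Subset n)
    F = e₁ ∷ saturate G

    e₁⊆G : e₁ ⊆ G
    e₁⊆G = p⊆p∪q e₂

    e₂⊆G : e₂ ⊆ G
    e₂⊆G = q⊆p∪q e₁ e₂

    G∖e₁⊆e₂ : ∀ {a} → a ∈ G → a ∉ e₁ → a ∈ e₂
    G∖e₁⊆e₂ a∈G a∉e₁ with x∈p∪q⁻ e₁ e₂ a∈G
    ... | inj₁ a∈e₁ = contradiction a∈e₁ a∉e₁
    ... | inj₂ a∈e₂ = a∈e₂

    e₂∩e₁=∅ : Disjoint e₂ e₁
    e₂∩e₁=∅ a∈e₂ a∈e₁ = e₁∩e₂=∅ a∈e₁ a∈e₂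

    e₁⊂G : e₁ ⊂ G
    e₁⊂G = e₁⊆G , z , e₂⊆G z∈e₂ , e₂∩e₁=∅ z∈e₂

    e₂-above-e₁ : EdgeGap E e₁ (saturate G)
    e₂-above-e₁ = EdgeGap-first E (saturate-chain⊆ G) e₂∈E (λ a∈e₂ → x∈p∧x∉q⇒x∈p─q (e₂⊆G a∈e₂) (e₂∩e₁=∅ a∈e₂))

    F-face : ColoringFace E F
    F-face = (∈⇒⊥⊂ x∈e₁ , saturate-chain e₁⊂G) , inj₁ (e₁ , e₁∈E , p⊆p─⊥)

    missing-e₁⇒∉F : ∀ {a Y} → a ∈ e₁ → a ∉ Y → Y ∉ₗ F
    missing-e₁⇒∉F a∈e₁ a∉Y (Any.here refl)    = a∉Y a∈e₁
    missing-e₁⇒∉F a∈e₁ a∉Y (Any.there Y∈sat) = a∉Y (saturate-⊇ Y∈sat (e₁⊆G a∈e₁))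

    red : Subset n
    red = ⁅ x ⁆

    red′ : Subset n
    red′ = e₁ ─ ⁅ w ⁆

    blue : Subset n
    blue = G ─ ⁅ z′ ⁆

    y∉red : y ∉ red
    y∉red = x≢y⇒x∉⁅y⁆ y≢x

    red⊂red′ : red ⊂ red′
    red⊂red′ = ⁅x⁆⊆p (x∈p∧x≢y⇒x∈p-y x∈e₁ (w≢x ∘ sym)) , y , x∈p∧x≢y⇒x∈p-y y∈e₁ (w≢y ∘ sym) , y∉red

    red-edge : Link K E F (red ∷ red′ ∷ [])
    red-edge = Link-intro K E [] (red ∷ red′ ∷ []) F (red⊂red′ ∷ [-])
      (λ { _ (Any.here refl) → missing-e₁⇒∉F y∈e₁ y∉red
         ; _ (Any.there (Any.here refl)) → missing-e₁⇒∉F w∈e₁ x∉p─⁅x⁆ })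
      ((∈⇒⊥⊂ (x∈⁅x⁆ x) , red⊂red′ , x∈p⇒p-x⊂p w∈e₁ , saturate-chain e₁⊂G) ,
       inj₂ (inj₂ (inj₂ e₂-above-e₁)))

    e₁⊂blue : e₁ ⊂ blue
    e₁⊂blue = (λ a∈e₁ → x∈p∧x≢y⇒x∈p-y (e₁⊆G a∈e₁) λ { refl → e₂∩e₁=∅ z′∈e₂ a∈e₁ }) ,
              z , x∈p∧x≢y⇒x∈p-y (e₂⊆G z∈e₂) z≢z′ , e₂∩e₁=∅ z∈e₂

    blue-vertex : Link K E F (blue ∷ [])
    blue-vertex = Link-intro K E (e₁ ∷ []) (blue ∷ []) (saturate G) [-]
      (λ { _ (Any.here refl) → λ where
             (Any.here e)      → ⊂-irref (sym e) e₁⊂blue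
             (Any.there b∈sat) → x∉p─⁅x⁆ (saturate-⊇ b∈sat (e₂⊆G z′∈e₂)) })
      ((∈⇒⊥⊂ x∈e₁ , e₁⊂blue , saturate-chain (x∈p⇒p-x⊂p (e₂⊆G z′∈e₂))) , inj₁ (e₁ , e₁∈E , p⊆p─⊥))

    no-edge-leaves-e₁ : ∀ {u v} → Link K E F (u ∷ v ∷ []) → u ⊆ e₁ → ¬ ¬ (v ⊆ e₁)
    no-edge-leaves-e₁ {u} {v} uv u⊆e₁ v⊈e₁ = e₁-splits-edge (unsplit-F (Any.here refl))
      where
      open LinkEdge K E uv

      u⊂e₁ : u ⊂ e₁
      u⊂e₁ = ⊆∧≢⇒⊂ u⊆e₁ λ { refl → u∉F (Any.here refl) }

      e₁⊂v : e₁ ⊂ v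
      e₁⊂v with comparable-v (Any.here refl)
      ... | inj₁ e₁⊆v = ⊆∧≢⇒⊂ e₁⊆v λ { refl → v∉F (Any.here refl) }
      ... | inj₂ v⊆e₁ = ⊥-elim (v⊈e₁ v⊆e₁)

      v⊂G : v ⊂ G
      v⊂G = below-saturate (comparable-v ∘ Any.there) (v∉F ∘ Any.there) v⊂⊤

      edge⊆G : edge ⊆ G
      edge⊆G = unsplit-saturate⇒⊆ (unsplit-F ∘ Any.there) (sizes edge edge∈E)

      edge⊆e₂ : Disjoint edge e₁ → edge ⊆ e₂
      edge⊆e₂ edge∩e₁=∅ b∈edge = G∖e₁⊆e₂ (edge⊆G b∈edge) (edge∩e₁=∅ b∈edge)

      edge⊂e₂ : Disjoint edge e₁ → Unsplit edge v → edge ⊂ e₂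
      edge⊂e₂ edge∩e₁=∅ (inj₁ edge⊆v) =
        let (_ , a , a∈G , a∉v) = v⊂G in
        edge⊆e₂ edge∩e₁=∅ , a , G∖e₁⊆e₂ a∈G (a∉v ∘ proj₁ e₁⊂v) , a∉v ∘ edge⊆v
      edge⊂e₂ edge∩e₁=∅ (inj₂ edge∩v=∅) =
        let (_ , a , a∈v , a∉e₁) = e₁⊂v in
        edge⊆e₂ edge∩e₁=∅ , a , G∖e₁⊆e₂ (proj₁ v⊂G a∈v) a∉e₁ , λ a∈edge → edge∩v=∅ a∈edge a∈v

      e₁-splits-edge : ¬ Unsplit edge e₁
      e₁-splits-edge (inj₁ edge⊆e₁)    = antichain edge e₁ edge∈E e₁∈E (unsplit-below⇒⊂ unsplit-u ⊥⊂u u⊂e₁ edge⊆e₁)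
      e₁-splits-edge (inj₂ edge∩e₁=∅) = antichain edge e₂ edge∈E e₂∈E (edge⊂e₂ edge∩e₁=∅ unsplit-v)

    no-edge-crosses-e₁ : ∀ {u v} → Link K E F (u ∷ v ∷ []) → u ⊆ e₁ ⇔ v ⊆ e₁
    no-edge-crosses-e₁ {u} {v} uv = mk⇔ to from
      where
      to : u ⊆ e₁ → v ⊆ e₁
      to u⊆e₁ = decidable-stable (v ⊆? e₁) (no-edge-leaves-e₁ uv u⊆e₁)
      from : v ⊆ e₁ → u ⊆ e₁
      from = ⊆-trans (proj₁ (LinkEdge.u⊂v K E uv))

    disconnectedLink : DisconnectedLink K E
    disconnectedLink = record
      { face          = F
      ; isFace        = F-face
      ; link-edge     = red-edge
      ; disconnection = record
        { Red           = _⊆ e₁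
        ; Red?          = _⊆? e₁
        ; red           = red
        ; blue          = blue
        ; red-vertex    = proj₁ (Link-edge⇒vertices K E red-edge)
        ; blue-vertex   = blue-vertex
        ; red-isRed     = ⁅x⁆⊆p x∈e₁
        ; blue-notRed   = λ blue⊆e₁ → e₂∩e₁=∅ z∈e₂ (blue⊆e₁ (proj₁ (proj₂ (proj₂ e₁⊂blue))))
        ; monochromatic = no-edge-crosses-e₁
        }
      }

  module PairEdge
      {g e : Subset n} (g∈E : g ∈ₗ E) (e∈E : e ∈ₗ E)
      {a b x y : Fin n} (a∈g : a ∈ g) (b∉g : b ∉ g) (e⊆ab : ∀ {w} → w ∈ e → w ≡ a ⊎ w ≡ b)
      (x∈g : x ∈ g) (y∈g : y ∈ g) (x≢a : x ≢ a) (y≢a : y ≢ a) (y≢x : y ≢ x) where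

    -- G may be all of [n]; then F is the empty face and its link is Δ_H itself.
    G : Subset n
    G = g ∪ ⁅ b ⁆

    F : List (Subset n)
    F = saturate G

    g⊆G : g ⊆ G
    g⊆G = p⊆p∪q ⁅ b ⁆

    b∈G : b ∈ G
    b∈G = q⊆p∪q g ⁅ b ⁆ (x∈⁅x⁆ b)

    G∖g≡b : ∀ {w} → w ∈ G → w ∉ g → w ≡ b
    G∖g≡b w∈G w∉g with x∈p∪q⁻ g ⁅ b ⁆ w∈G
    ... | inj₁ w∈g   = contradiction w∈g w∉g
    ... | inj₂ w∈⁅b⁆ = x∈⁅y⁆⇒x≡y b w∈⁅b⁆

    g⊂G : g ⊂ G
    g⊂G = g⊆G , b , b∈G , b∉g

    e⊆G : e ⊆ G
    e⊆G w∈e with e⊆ab w∈e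
    ... | inj₁ refl = g⊆G a∈g
    ... | inj₂ refl = b∈G

    e-above : ∀ {p} → Disjoint e p → EdgeGap E p F
    e-above e∩p=∅ = EdgeGap-first E (saturate-chain⊆ G) e∈E (λ w∈e → x∈p∧x∉q⇒x∈p─q (e⊆G w∈e) (e∩p=∅ w∈e))

    F-face : ColoringFace E F
    F-face = saturate-chain (∈⇒⊥⊂ (g⊆G a∈g)) , e-above (λ _ → ∉⊥)

    missing-G⇒∉F : ∀ {w Y} → w ∈ G → w ∉ Y → Y ∉ₗ F
    missing-G⇒∉F w∈G w∉Y Y∈F = w∉Y (saturate-⊇ Y∈F w∈G)

    red-vertex : Link K E F (g ∷ [])
    red-vertex = Link-intro K E [] (g ∷ []) F [-]
      (λ { _ (Any.here refl) → missing-G⇒∉F b∈G b∉g })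
      ((∈⇒⊥⊂ a∈g , saturate-chain g⊂G) , inj₁ (g , g∈E , p⊆p─⊥))

    blue : Subset n
    blue = ⁅ x ⁆

    blue′ : Subset n
    blue′ = g ─ ⁅ a ⁆

    y∉blue : y ∉ blue
    y∉blue = x≢y⇒x∉⁅y⁆ y≢x

    blue⊂blue′ : blue ⊂ blue′
    blue⊂blue′ = ⁅x⁆⊆p (x∈p∧x≢y⇒x∈p-y x∈g x≢a) , y , x∈p∧x≢y⇒x∈p-y y∈g y≢a , y∉blue

    e∩blue′=∅ : Disjoint e blue′
    e∩blue′=∅ w∈e with e⊆ab w∈e
    ... | inj₁ refl = x∉p─⁅x⁆
    ... | inj₂ refl = b∉g ∘ p─q⊆p g ⁅ a ⁆

    blue-edge : Link K E F (blue ∷ blue′ ∷ [])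
    blue-edge = Link-intro K E [] (blue ∷ blue′ ∷ []) F (blue⊂blue′ ∷ [-])
      (λ { _ (Any.here refl)             → missing-G⇒∉F (g⊆G a∈g) (x≢y⇒x∉⁅y⁆ (x≢a ∘ sym))
         ; _ (Any.there (Any.here refl)) → missing-G⇒∉F (g⊆G a∈g) x∉p─⁅x⁆ })
      ((∈⇒⊥⊂ (x∈⁅x⁆ x) , blue⊂blue′ , saturate-chain (⊂-⊆-trans (x∈p⇒p-x⊂p a∈g) g⊆G)) ,
       inj₂ (inj₂ (e-above e∩blue′=∅)))

    -- The element of v ∖ g and the element of G ∖ v would both have to be b.
    nothing-above-g : ∀ {v} → ¬ Link K E F (g ∷ v ∷ [])
    nothing-above-g {v} gv =
      let (_ , j , j∈v , j∉g)   = u⊂v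
          (v⊆G , k , k∈G , k∉v) = below-saturate comparable-v v∉F v⊂⊤
      in k∉v (subst (_∈ v) (trans (G∖g≡b (v⊆G j∈v) j∉g) (sym (G∖g≡b k∈G (k∉v ∘ proj₁ u⊂v)))) j∈v)
      where open LinkEdge K E gv

    nothing-below-g : ∀ {u} → ¬ Link K E F (u ∷ g ∷ [])
    nothing-below-g ug = g-splits-edge unsplit-v
      where
      open LinkEdge K E ug

      edge⊆G : edge ⊆ G
      edge⊆G = unsplit-saturate⇒⊆ unsplit-F (sizes edge edge∈E)

      only-b : Disjoint edge g → ∀ {w} → w ∈ edge → w ≡ b
      only-b edge∩g=∅ w∈edge = G∖g≡b (edge⊆G w∈edge) (edge∩g=∅ w∈edge)

      g-splits-edge : ¬ Unsplit edge g
      g-splits-edge (inj₁ edge⊆g)    = antichain edge g edge∈E g∈E (unsplit-below⇒⊂ unsplit-u ⊥⊂u u⊂v edge⊆g)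
      g-splits-edge (inj₂ edge∩g=∅) =
        let (c , c∈edge , _)       = ∃-∉ edge [] (ℕ.<⇒≤ (sizes edge edge∈E))
            (c′ , c′∈edge , c′∉[c]) = ∃-∉ edge (c ∷ []) (sizes edge edge∈E)
        in c′∉[c] (Any.here (trans (only-b edge∩g=∅ c′∈edge) (sym (only-b edge∩g=∅ c∈edge))))

    no-edge-meets-g : ∀ {u v} → Link K E F (u ∷ v ∷ []) → u ≡ g ⇔ v ≡ g
    no-edge-meets-g uv = mk⇔ (λ { refl → ⊥-elim (nothing-above-g uv) }) (λ { refl → ⊥-elim (nothing-below-g uv) })

    disconnectedLink : DisconnectedLink K E
    disconnectedLink = record
      { face          = F
      ; isFace        = F-face
      ; link-edge     = blue-edge
      ; disconnection = record
        { Red           = _≡ g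
        ; Red?          = _≟ˢ g
        ; red           = g
        ; blue          = blue
        ; red-vertex    = red-vertex
        ; blue-vertex   = proj₁ (Link-edge⇒vertices K E blue-edge)
        ; red-isRed     = refl
        ; blue-notRed   = λ blue≡g → y∉blue (subst (y ∈_) (sym blue≡g) y∈g)
        ; monochromatic = no-edge-meets-g
        }
      }

  small-edge⇒pair : ∀ {g e a} → g ∈ₗ E → e ∈ₗ E → 3 ≤ ∣ g ∣ → ¬ (3 ≤ ∣ e ∣) → a ∈ g → a ∈ e →
                    ∃[ b ] (b ∈ e × b ∉ g × (∀ {w} → w ∈ e → w ≡ a ⊎ w ≡ b))
  small-edge⇒pair {g} {e} {a} g∈E e∈E 3≤∣g∣ ∣e∣≱3 a∈g a∈e with ∃-∉ e (a ∷ []) (sizes e e∈E)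
  ... | b , b∈e , b∉[a] = b , b∈e , b∉g , e⊆ab
    where
    e⊆ab : ∀ {w} → w ∈ e → w ≡ a ⊎ w ≡ b
    e⊆ab {w} w∈e with w ≟ a | w ≟ b
    ... | yes w≡a | _       = inj₁ w≡a
    ... | no _    | yes w≡b = inj₂ w≡b
    ... | no w≢a  | no w≢b  = ⊥-elim (∣e∣≱3 (Unique⇒length≤∣p∣
      (((b∉[a] ∘ Any.here ∘ sym) ∷ (w≢a ∘ sym) ∷ []) ∷ ((w≢b ∘ sym) ∷ []) ∷ [] ∷ [])
      (a∈e ∷ b∈e ∷ w∈e ∷ [])))

    b∉g : b ∉ g
    b∉g b∈g with ∃-∉ g (a ∷ b ∷ []) 3≤∣g∣
    ... | t , t∈g , t∉ab = antichain e g e∈E g∈E (e⊆g , t , t∈g , t∉e)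
      where
      e⊆g : e ⊆ g
      e⊆g w∈e with e⊆ab w∈e
      ... | inj₁ refl = a∈g
      ... | inj₂ refl = b∈g
      t∉e : t ∉ e
      t∉e t∈e with e⊆ab t∈e
      ... | inj₁ t≡a = t∉ab (Any.here t≡a)
      ... | inj₂ t≡b = t∉ab (Any.there (Any.here t≡b))

  largeDisjointEdges⇒disconnectedLink : ∀ {e₁ e₂} → e₁ ∈ₗ E → e₂ ∈ₗ E → 3 ≤ ∣ e₁ ∣ → Disjoint e₁ e₂ →
                                        DisconnectedLink K E
  largeDisjointEdges⇒disconnectedLink {e₁} {e₂} e₁∈E e₂∈E 3≤∣e₁∣ e₁∩e₂=∅
    with ∃-∉ e₁ [] (ℕ.≤-trans (s≤s z≤n) 3≤∣e₁∣) | ∃-∉ e₂ [] (ℕ.<⇒≤ (sizes e₂ e₂∈E))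
  ... | x , x∈e₁ , _ | z , z∈e₂ , _
    with ∃-∉ e₁ (x ∷ []) (ℕ.≤-trans (s≤s (s≤s z≤n)) 3≤∣e₁∣) | ∃-∉ e₂ (z ∷ []) (sizes e₂ e₂∈E)
  ... | y , y∈e₁ , y∉[x] | z′ , z′∈e₂ , z′∉[z]
    with ∃-∉ e₁ (x ∷ y ∷ []) 3≤∣e₁∣
  ... | w , w∈e₁ , w∉[x,y] =
    LargeDisjointEdges.disconnectedLink e₁∈E e₂∈E e₁∩e₂=∅ x∈e₁ y∈e₁ w∈e₁ z∈e₂ z′∈e₂
      (y∉[x] ∘ Any.here) (w∉[x,y] ∘ Any.here) (w∉[x,y] ∘ Any.there ∘ Any.here) (z′∉[z] ∘ Any.here ∘ sym)

  pairEdge⇒disconnectedLink : ∀ {g e a} → g ∈ₗ E → e ∈ₗ E → 3 ≤ ∣ g ∣ → ¬ (3 ≤ ∣ e ∣) → a ∈ g × a ∈ e →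
                              DisconnectedLink K E
  pairEdge⇒disconnectedLink {g} {a = a} g∈E e∈E 3≤∣g∣ ∣e∣≱3 (a∈g , a∈e)
    with small-edge⇒pair g∈E e∈E 3≤∣g∣ ∣e∣≱3 a∈g a∈e | ∃-∉ g (a ∷ []) (ℕ.≤-trans (s≤s (s≤s z≤n)) 3≤∣g∣)
  ... | b , _ , b∉g , e⊆ab | x , x∈g , x∉[a]
    with ∃-∉ g (a ∷ x ∷ []) 3≤∣g∣
  ... | y , y∈g , y∉[a,x] =
    PairEdge.disconnectedLink g∈E e∈E a∈g b∉g e⊆ab
      x∈g y∈g (x∉[a] ∘ Any.here) (y∉[a,x] ∘ Any.here) (y∉[a,x] ∘ Any.there ∘ Any.here)

  disconnectedLink : (∃[ g ] (g ∈ₗ E × 2 < ∣ g ∣)) → (∃[ e ] ∃[ e′ ] (e ∈ₗ E × e′ ∈ₗ E × Empty (e ∩ e′))) →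
                     DisconnectedLink K E
  disconnectedLink (g , g∈E , 3≤∣g∣) (e , e′ , e∈E , e′∈E , e∩e′=∅) with 3 ≤? ∣ e ∣ | nonempty? (g ∩ e)
  ... | yes 3≤∣e∣ | _                = largeDisjointEdges⇒disconnectedLink e∈E e′∈E 3≤∣e∣ (Empty∩⇒Disjoint e∩e′=∅)
  ... | no _      | no g∩e=∅         = largeDisjointEdges⇒disconnectedLink g∈E e∈E 3≤∣g∣ (Empty∩⇒Disjoint g∩e=∅)
  ... | no ∣e∣≱3  | yes (_ , a∈g∩e) = pairEdge⇒disconnectedLink g∈E e∈E 3≤∣g∣ ∣e∣≱3 (x∈p∩q⁻ g e a∈g∩e)

proposition3p6 : ∀ {c ℓ : Level} (K : Field c ℓ) (n : ℕ) (E : List (Subset n)) →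
    IsHypergraph n E →
    (∃[ e ] (e ∈ₗ E × 2 < ∣ e ∣)) →
    (∃[ e ] ∃[ e' ] (e ∈ₗ E × e' ∈ₗ E × Empty (e ∩ e'))) →
    ¬ CohenMacaulay K (allSubsets n) _⊂_ (ColoringFace E)
proposition3p6 K n E (sizes , _ , antichain) large-edge disjoint-edges =
  disconnectedLink⇒¬CohenMacaulay K E (disconnectedLink K E sizes antichain large-edge disjoint-edges)
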